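{- Let $\Gamma$ and $\Gamma'$ be triangulations of connected closed surfaces $M$ and $M'$, and let $F$, $F'$ be faces of $\Gamma$, $\Gamma'$, respectively. For every special homeomorphism $g:\partial F\to\partial F'$, the connected sum $\Gamma\#_g\Gamma'$ is $3$-colorable if and only if both $\Gamma$ and $\Gamma'$ are $3$-colorable.
   Context: A triangulation of a connected closed $2$-dimensional surface (not necessarily orientable) is a closed $2$-cell embedding of a connected finite simple graph in which every face is a triangle. $3$-colorable means the graph admits a proper vertex coloring with $3$ colors. A homeomorphism $g:\partial F\to\partial F'$ between boundaries of faces is special if it maps vertices to vertices. The connected sum $\Gamma\#_g\Gamma'$ is the triangulation of $M\# M'$ obtained by removing the interiors of $F$ and $F'$ and gluing $\partial F$ to $\partial F'$ via $g$ (so each vertex $v$ of $F$ is identified with $g(v)$). -}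

module Defs where

open import Data.Nat using (ℕ; _<_)
open import Data.Fin using (Fin; _≟_)
open import Data.Fin.Properties using (any?)
open import Data.Fin.Permutation using (Permutation′; _⟨$⟩ˡ_)
open import Data.Product using (Σ; ∃; ∃₂; _×_; _,_)
open import Data.Sum using (_⊎_; inj₁; inj₂)
open import Relation.Nullary using (¬_; yes; no)
open import Relation.Binary.PropositionalEquality using (_≡_; _≢_)
open import Relation.Binary.Construct.Closure.ReflexiveTransitive using (Star)

record Complex : Set₁ where
  field
    V    : Set
    Face : Set
    vert : Face → Fin 3 → V

open Complex public

Incident : (C : Complex) → Face C → V C → V C → Set
Incident C x u v = ∃₂ λ i j → vert C x i ≡ u × vert C x j ≡ v

Adj : (C : Complex) → V C → V C → Set
Adj C u v = u ≢ v × ∃ λ x → Incident C x u v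

ThreeColorable : Complex → Set
ThreeColorable C = ∃ λ (c : V C → Fin 3) → ∀ u v → Adj C u v → c u ≢ c v

finComplex : {n f : ℕ} → (Fin f → Fin 3 → Fin n) → Complex
finComplex {n} {f} t = record { V = Fin n ; Face = Fin f ; vert = t }

-- Two faces x, y both contain vertex v and share an edge {v,w} with w ≠ v
-- (adjacency of faces around v, i.e. adjacency in the link of v).
LinkAdj : (C : Complex) → V C → Face C → Face C → Set
LinkAdj C v x y = ∃ λ w → w ≢ v × Incident C x v w × Incident C y v w

-- Combinatorial triangulation of a connected closed surface:
--  * every face is a triangle with three distinct corners;
--  * there is at least one face and every vertex lies on a face;
--  * every edge lies on exactly two faces;
--  * the link of every vertex is a single cycle (the faces around a vertex
--    are connected through shared edges), so the space is a 2-manifold;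
--  * the graph is connected.
record IsSurfaceTriangulation {n f : ℕ} (t : Fin f → Fin 3 → Fin n) : Set where
  C = finComplex t
  field
    nonempty  : 0 < f
    corners   : ∀ x i j → i ≢ j → t x i ≢ t x j
    covers    : ∀ v → ∃₂ λ x i → t x i ≡ v
    edgeTwo   : ∀ x i j → i ≢ j →
                Σ (Fin f) λ y → Σ (Fin f) λ z → y ≢ z
                × Incident C y (t x i) (t x j) × Incident C z (t x i) (t x j)
                × (∀ w → Incident C w (t x i) (t x j) → w ≡ y ⊎ w ≡ z)
    linkConn  : ∀ v x y → Incident C x v v → Incident C y v v →
                Star (LinkAdj C v) x y
    connected : ∀ u v → Star (Adj C) u v

-- The special homeomorphism g : ∂F → ∂F' is given by a permutation σ of the
-- corners: g sends corner i of F to corner σ i of F'.  Vertices of the sum: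
-- all vertices of Γ, plus the vertices of Γ' not on F'; the corner σ i of F'
-- is identified with corner i of F.
module ConnSum {n f n' f' : ℕ} (t : Fin f → Fin 3 → Fin n) (t' : Fin f' → Fin 3 → Fin n')
               (F : Fin f) (F' : Fin f') (σ : Permutation′ 3) where

  OnF' : Fin n' → Set
  OnF' w = ∃ λ j → w ≡ t' F' j

  SumV : Set
  SumV = Fin n ⊎ Σ (Fin n') λ w → ¬ OnF' w

  SumFace : Set
  SumFace = (Σ (Fin f) λ x → x ≢ F) ⊎ (Σ (Fin f') λ y → y ≢ F')

  glue : Fin n' → SumV
  glue w with any? (λ j → w ≟ t' F' j)
  ... | yes (j , _) = inj₁ (t F (σ ⟨$⟩ˡ j))
  ... | no ¬p       = inj₂ (w , ¬p)

  sumVert : SumFace → Fin 3 → SumV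
  sumVert (inj₁ (x , _)) i = inj₁ (t x i)
  sumVert (inj₂ (y , _)) i = glue (t' y i)

  complex : Complex
  complex = record { V = SumV ; Face = SumFace ; vert = sumVert }

connectedSum : {n f n' f' : ℕ} (t : Fin f → Fin 3 → Fin n) (t' : Fin f' → Fin 3 → Fin n')
               (F : Fin f) (F' : Fin f') (σ : Permutation′ 3) → Complex
connectedSum t t' F F' σ = ConnSum.complex t t' F F' σ

{-# OPTIONS --safe #-}
-- Every edge of a surface triangulation lies on two faces, so it survives the
-- removal of F: the vertices of Γ and of Γ' sit in Γ #_g Γ' with all their
-- adjacencies, and a colouring of the sum restricts to both.  Conversely, a
-- proper 3-colouring gives the three corners of a face three distinct colours,
-- so after permuting the colours of Γ' the two colourings agree along g and
-- glue to a colouring of the sum.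
module Submission where

open import Defs
open import Data.Empty using (⊥-elim)
open import Data.Nat using (ℕ; suc)
open import Data.Nat.Properties using (n<1+n)
open import Data.Fin using (Fin; _≟_; punchOut)
open import Data.Fin.Properties using (any?; punchOut-injective; <⇒notInjective)
open import Data.Fin.Permutation using (Permutation′; _⟨$⟩ˡ_; flip)
open import Data.Product using (_×_; ∃; _,_; proj₁; proj₂)
open import Data.Sum using (inj₁; inj₂)
open import Data.Sum.Properties using (inj₁-injective; inj₂-injective)
open import Function using (_∘_)
open import Function.Bundles using (_⇔_; mk⇔; Injection)
open import Function.Definitions using (Injective)
open import Function.Properties.Inverse using (↔⇒↣)
open import Relation.Nullary using (¬_; yes; no; contradiction)
open import Relation.Binary.PropositionalEquality

injective⇒surjective : ∀ {n} {f : Fin n → Fin n} → Injective _≡_ _≡_ f →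
                       ∀ k → ∃ λ j → f j ≡ k
injective⇒surjective {suc n} {f} f-inj k with any? (λ j → f j ≟ k)
... | yes hit = hit
... | no miss = ⊥-elim (<⇒notInjective (n<1+n n) punchOut∘f-injective)
  where
  punchOut∘f : Fin (suc n) → Fin n
  punchOut∘f j = punchOut {i = k} {j = f j} (miss ∘ (j ,_) ∘ sym)

  punchOut∘f-injective : Injective _≡_ _≡_ punchOut∘f
  punchOut∘f-injective {i} {j} = f-inj ∘ punchOut-injective (miss ∘ (i ,_) ∘ sym) (miss ∘ (j ,_) ∘ sym)

injective-factorisation : ∀ {n} {a b : Fin n → Fin n} →
                          Injective _≡_ _≡_ a → Injective _≡_ _≡_ b →
                          ∃ λ d → Injective _≡_ _≡_ d × (∀ j → d (a j) ≡ b j)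
injective-factorisation {a = a} {b} a-inj b-inj = d , d-injective , d∘a≗b
  where
  a⁻¹ : Fin _ → Fin _
  a⁻¹ k = proj₁ (injective⇒surjective a-inj k)

  a∘a⁻¹ : ∀ k → a (a⁻¹ k) ≡ k
  a∘a⁻¹ k = proj₂ (injective⇒surjective a-inj k)

  d : Fin _ → Fin _
  d = b ∘ a⁻¹

  d-injective : Injective _≡_ _≡_ d
  d-injective {k} {k′} eq = trans (sym (a∘a⁻¹ k)) (trans (cong a (b-inj eq)) (a∘a⁻¹ k′))

  d∘a≗b : ∀ j → d (a j) ≡ b j
  d∘a≗b j = cong b (a-inj (a∘a⁻¹ (a j)))

distinct⇒injective : ∀ {a} {A : Set a} {m} {g : Fin m → A} →
                     (∀ i j → i ≢ j → g i ≢ g j) → Injective _≡_ _≡_ g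
distinct⇒injective distinct {i} {j} eq with i ≟ j
... | yes i≡j = i≡j
... | no i≢j = contradiction eq (distinct i j i≢j)

Proper : (C : Complex) {k : ℕ} → (V C → Fin k) → Set
Proper C c = ∀ u v → Adj C u v → c u ≢ c v

module _ {C : Complex} where

  face-Adj : ∀ {x i j} → vert C x i ≢ vert C x j → Adj C (vert C x i) (vert C x j)
  face-Adj {x} {i} {j} ne = ne , x , i , j , refl , refl

  proper-on-faces : ∀ {k} (c : V C → Fin k) →
                    (∀ x i j → vert C x i ≢ vert C x j → c (vert C x i) ≢ c (vert C x j)) →
                    Proper C c
  proper-on-faces c proper u v (u≢v , x , i , j , refl , refl) = proper x i j u≢v

  proper-pullback : ∀ {D : Complex} {k} {c : V D → Fin k} (h : V C → V D) →
                    (∀ {u v} → Adj C u v → Adj D (h u) (h v)) →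
                    Proper D c → Proper C (c ∘ h)
  proper-pullback h h-Adj c-proper u v = c-proper (h u) (h v) ∘ h-Adj

  corner-colours-injective : ∀ {k} {c : V C → Fin k} {x} →
                             (∀ i j → i ≢ j → vert C x i ≢ vert C x j) → Proper C c →
                             Injective _≡_ _≡_ (c ∘ vert C x)
  corner-colours-injective distinct c-proper =
    distinct⇒injective λ i j i≢j → c-proper _ _ (face-Adj (distinct i j i≢j))

module _ {n f} {t : Fin f → Fin 3 → Fin n} (Γ : IsSurfaceTriangulation t) where
  open IsSurfaceTriangulation Γ

  edge-on-face-other-than : ∀ G {u v} → Adj C u v → ∃ λ y → y ≢ G × Incident C y u v
  edge-on-face-other-than G (u≢v , x , i , j , refl , refl)
    with y , z , y≢z , on-y , on-z , _ ← edgeTwo x i j (u≢v ∘ cong (t x))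
    with y ≟ G
  ... | no y≢G = y , y≢G , on-y
  ... | yes refl = z , y≢z ∘ sym , on-z

module ConnectedSum {n f n' f'} {t : Fin f → Fin 3 → Fin n} {t' : Fin f' → Fin 3 → Fin n'}
         (Γ : IsSurfaceTriangulation t) (Γ' : IsSurfaceTriangulation t')
         (F : Fin f) (F' : Fin f') (σ : Permutation′ 3) where
  open ConnSum t t' F F' σ

  data GlueView (w : Fin n') : SumV → Set where
    onF'  : ∀ j → w ≡ t' F' j → GlueView w (inj₁ (t F (σ ⟨$⟩ˡ j)))
    offF' : (w∉F' : ¬ OnF' w) → GlueView w (inj₂ (w , w∉F'))

  glue-view : ∀ w → GlueView w (glue w)
  glue-view w with any? (λ j → w ≟ t' F' j)
  ... | yes (j , w≡j) = onF' j w≡j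
  ... | no w∉F' = offF' w∉F'

  σ⁻¹-injective : Injective _≡_ _≡_ (σ ⟨$⟩ˡ_)
  σ⁻¹-injective = Injection.injective (↔⇒↣ (flip σ))

  glued-corner-colours-injective : ∀ {k} {c : Fin n → Fin k} → Proper (finComplex t) c →
                                   Injective _≡_ _≡_ (λ j → c (t F (σ ⟨$⟩ˡ j)))
  glued-corner-colours-injective c-proper =
    σ⁻¹-injective ∘ corner-colours-injective (IsSurfaceTriangulation.corners Γ F) c-proper

  glue-injective : Injective _≡_ _≡_ glue
  glue-injective {u} {v} eq with glue u | glue-view u | glue v | glue-view v
  glue-injective eq | _ | onF' j refl | _ | onF' k refl =
    cong (t' F') (σ⁻¹-injective (distinct⇒injective (IsSurfaceTriangulation.corners Γ F) (inj₁-injective eq)))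
  glue-injective () | _ | onF' _ _ | _ | offF' _
  glue-injective () | _ | offF' _ | _ | onF' _ _
  glue-injective eq | _ | offF' _ | _ | offF' _ = cong proj₁ (inj₂-injective eq)

  inj₁-preserves-Adj : ∀ {u v} → Adj (finComplex t) u v → Adj complex (inj₁ u) (inj₁ v)
  inj₁-preserves-Adj adj@(u≢v , _)
    with y , y≢F , i , j , refl , refl ← edge-on-face-other-than Γ F adj =
    face-Adj {C = complex} {x = inj₁ (y , y≢F)} (u≢v ∘ inj₁-injective)

  glue-preserves-Adj : ∀ {u v} → Adj (finComplex t') u v → Adj complex (glue u) (glue v)
  glue-preserves-Adj adj@(u≢v , _)
    with y , y≢F' , i , j , refl , refl ← edge-on-face-other-than Γ' F' adj =
    face-Adj {C = complex} {x = inj₂ (y , y≢F')} (u≢v ∘ glue-injective)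

  glue-colourings : ∀ {c c'} → Proper (finComplex t) c → Proper (finComplex t') c' →
                    ThreeColorable complex
  glue-colourings {c} {c'} c-proper c'-proper = e , proper-on-faces e e-proper
    where
    recolouring : ∃ λ d → Injective _≡_ _≡_ d × (∀ j → d (c' (t' F' j)) ≡ c (t F (σ ⟨$⟩ˡ j)))
    recolouring = injective-factorisation
      (corner-colours-injective (IsSurfaceTriangulation.corners Γ' F') c'-proper)
      (glued-corner-colours-injective c-proper)

    d : Fin 3 → Fin 3
    d = proj₁ recolouring

    d-injective : Injective _≡_ _≡_ d
    d-injective = proj₁ (proj₂ recolouring)

    d-agrees-on-F : ∀ j → d (c' (t' F' j)) ≡ c (t F (σ ⟨$⟩ˡ j))
    d-agrees-on-F = proj₂ (proj₂ recolouring)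

    e : SumV → Fin 3
    e (inj₁ v) = c v
    e (inj₂ (w , _)) = d (c' w)

    e∘glue : ∀ w → e (glue w) ≡ d (c' w)
    e∘glue w with glue w | glue-view w
    ... | _ | onF' j refl = sym (d-agrees-on-F j)
    ... | _ | offF' _ = refl

    e-proper : ∀ x i j → sumVert x i ≢ sumVert x j → e (sumVert x i) ≢ e (sumVert x j)
    e-proper (inj₁ _) i j ne = c-proper _ _ (face-Adj (ne ∘ cong inj₁))
    e-proper (inj₂ (y , _)) i j ne rewrite e∘glue (t' y i) | e∘glue (t' y j) =
      c'-proper _ _ (face-Adj (ne ∘ cong glue)) ∘ d-injective

  restrict : ThreeColorable complex → ThreeColorable (finComplex t) × ThreeColorable (finComplex t')
  restrict (c , c-proper) =
    (c ∘ inj₁ , proper-pullback inj₁ inj₁-preserves-Adj c-proper) ,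
    (c ∘ glue , proper-pullback glue glue-preserves-Adj c-proper)

lemma3 : {n f n' f' : ℕ} (t : Fin f → Fin 3 → Fin n) (t' : Fin f' → Fin 3 → Fin n')
         → IsSurfaceTriangulation t → IsSurfaceTriangulation t'
         → (F : Fin f) (F' : Fin f') (σ : Permutation′ 3)
         → ThreeColorable (connectedSum t t' F F' σ)
           ⇔ (ThreeColorable (finComplex t) × ThreeColorable (finComplex t'))
lemma3 t t' Γ Γ' F F' σ =
  mk⇔ restrict λ ((_ , c-proper) , (_ , c'-proper)) → glue-colourings c-proper c'-proper
  where open ConnectedSum Γ Γ' F F' σ
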